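{- Let $m$ and $M$ be two positive integers with $\gcd(m,M)\neq 1$. Let $S = M^\alpha \cdot (M-1)^\beta \cdot (- m)^\gamma$ for some non-negative integers $\alpha, \beta, \gamma$. If $S$ is a minimal zero-sum sequence over $\llbracket -m,M \rrbracket$, then $|S| \le m+M-2$ if $\alpha > 0$, and $|S|\le m+M-3$ if $\gcd(m,M-1)\neq 1$.
   Context: Sequences of integers are unordered finite multisets written multiplicatively: $x^a$ denotes $a$ copies of $x$, $\cdot$ denotes concatenation; $|S|$ is the length (number of elements with multiplicity). $S=s_1\cdots s_n$ is a zero-sum sequence if $\sum s_i=0$, and a minimal zero-sum sequence if moreover $\sum_{i\in I}s_i\ne0$ for every non-empty proper $I\subsetneq\{1,\dots,n\}$. A sequence is over a set $A$ if all its elements lie in $A$. For integers $a\le b$, $\llbracket a,b\rrbracket$ is the set of integers between $a$ and $b$. -}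

module Defs where

open import Data.Nat as ℕ using (ℕ; _∸_)
open import Data.Integer as ℤ using (ℤ; +_; -_; _≤_)
open import Data.List using (List; []; _∷_; length; replicate; _++_)
open import Data.List.Relation.Unary.All using (All)
open import Data.List.Relation.Binary.Sublist.Propositional using (_⊆_)
open import Data.Product using (_×_)
open import Relation.Binary.PropositionalEquality using (_≡_)
open import Relation.Nullary using (¬_)

-- A sequence of integers is a finite list; order is irrelevant for all
-- notions below. Sub-sequences (sub-multisets, i.e. index subsets I) are
-- exactly sublists.
Seq : Set
Seq = List ℤ

σ : Seq → ℤ
σ [] = + 0
σ (x ∷ xs) = x ℤ.+ σ xs

IsZeroSum : Seq → Set
IsZeroSum S = σ S ≡ + 0

IsMinimalZeroSum : Seq → Set
IsMinimalZeroSum S =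
  IsZeroSum S ×
  (∀ (T : Seq) → T ⊆ S → 0 ℕ.< length T → length T ℕ.< length S → ¬ (σ T ≡ + 0))

IsOver : ℤ → ℤ → Seq → Set
IsOver a b S = All (λ x → (a ≤ x) × (x ≤ b)) S

_^^_ : ℤ → ℕ → Seq
x ^^ a = replicate a x

-- Minimality of S says that no sub-multiset M^a (M-1)^b with 0 < a + b < α + β has a sum
-- divisible by m: completed by the right number of copies of -m it would be a proper zero-sum
-- subsequence. List the positive terms with the copies of M first; the sums of the first k of
-- them, 0 ≤ k < α + β, are then pairwise incongruent modulo m, as two of them differ by such a
-- sub-multiset. If α > 0, M - 1 is incongruent to all of them too: the sums kM are divisible by
-- gcd(m, M), which does not divide M - 1, and a later sum minus M - 1 is again a proper sub-sum.
-- If gcd(m, M - 1) ≠ 1, it divides α (as γm = αM + β(M - 1)), so each partial sum is divisible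
-- by gcd(m, M) or by gcd(m, M - 1), while neither divides 1 or m - 1; and 1 ≢ m - 1 since m ≥ 3.
-- The pigeonhole principle gives α + β + 1 ≤ m, resp. α + β + 2 ≤ m, and γm = αM + β(M - 1) < mM
-- gives γ < M.

module Submission where

open import Defs
open import Data.Empty using (⊥-elim)
open import Data.Fin using (Fin; toℕ; fromℕ<)
open import Data.Fin.Properties using (injective⇒≤; toℕ-fromℕ<; toℕ<n)
import Data.Fin.Properties as Finₚ
open import Data.Integer using (+_; -_)
import Data.Integer as ℤ
import Data.Integer.Properties as ℤ
open import Data.List using ([]; _∷_; _++_; length)
open import Data.List.Properties using (length-++; length-replicate)
open import Data.List.Relation.Binary.Sublist.Propositional using (_⊆_; []; _∷_; _∷ʳ_)
open import Data.List.Relation.Binary.Sublist.Heterogeneous.Properties using (++⁺)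
open import Data.Nat using (ℕ; zero; suc; pred; _+_; _*_; _∸_; _⊓_; _<_; _≤_; z≤n; s≤s; NonZero)
open import Data.Nat.DivMod using (_%_; _/_; m≡m%n+[m/n]*n; m%n<n; m<n⇒m%n≡m)
open import Data.Nat.Divisibility
  using (_∣_; _∤_; divides; _∣0; n∣m*n; ∣1⇒≡1; ∣m+n∣m⇒∣n; ∣m∣n⇒∣m+n; ∣n⇒∣m*n; ∣m⇒∣m*n; ∣n∣m%n⇒∣m; %-presˡ-∣)
open import Data.Nat.GCD using (gcd; gcd[m,n]∣m; gcd[m,n]∣n)
open import Data.Nat.Primality using (irreducible[2])
open import Data.Nat.Properties
open import Data.Nat.Tactic.RingSolver using (solve-∀)
open import Algebra.Properties.CommutativeSemigroup +-commutativeSemigroup using (interchange)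
open import Data.Product using (_×_; _,_; proj₁)
open import Data.Sum using (inj₁; inj₂)
open import Data.Vec.Functional using (Vector) renaming (_∷_ to _◂_)
open import Function using (_∘_; _⇔_; mk⇔; Equivalence)
open import Function.Definitions using (Injective)
open import Relation.Binary.Definitions using (tri<; tri≈; tri>)
open import Relation.Binary.PropositionalEquality
  using (_≡_; _≢_; refl; sym; trans; cong; cong₂; subst; subst₂; module ≡-Reasoning)
open import Relation.Nullary using (¬_; yes; no)

module _ {n : ℕ} .{{_ : NonZero n}} where

  m%n≡[m+o]%n⇒n∣o : ∀ m o → m % n ≡ (m + o) % n → n ∣ o
  m%n≡[m+o]%n⇒n∣o m o eq = ∣m+n∣m⇒∣n (divides ((m + o) / n) (+-cancelˡ-≡ (m % n) _ _ (begin
      m % n + (m / n * n + o)       ≡⟨ +-assoc (m % n) _ o ⟨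
      m % n + m / n * n + o         ≡⟨ cong (_+ o) (m≡m%n+[m/n]*n m n) ⟨
      m + o                         ≡⟨ m≡m%n+[m/n]*n (m + o) n ⟩
      (m + o) % n + (m + o) / n * n ≡⟨ cong (_+ (m + o) / n * n) eq ⟨
      m % n + (m + o) / n * n       ∎)))
    (n∣m*n (m / n))
    where open ≡-Reasoning

  ∣n∣m∧m%n≡o%n⇒∣o : ∀ {d m o} → d ∣ n → d ∣ m → m % n ≡ o % n → d ∣ o
  ∣n∣m∧m%n≡o%n⇒∣o {d} d∣n d∣m eq = ∣n∣m%n⇒∣m d∣n (subst (d ∣_) eq (%-presˡ-∣ d∣m d∣n))

  %-injective⇒≤ : ∀ {k} {f : Vector ℕ k} → Injective _≡_ _≡_ (λ i → f i % n) → k ≤ n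
  %-injective⇒≤ {f = f} inj = injective⇒≤ λ {i} {j} eq → inj (begin
      f i % n                      ≡⟨ toℕ-fromℕ< (m%n<n (f i) n) ⟨
      toℕ (fromℕ< (m%n<n (f i) n)) ≡⟨ cong toℕ eq ⟩
      toℕ (fromℕ< (m%n<n (f j) n)) ≡⟨ toℕ-fromℕ< (m%n<n (f j) n) ⟩
      f j % n                      ∎)
    where open ≡-Reasoning

  ◂-%-injective : ∀ {k r} {f : Vector ℕ k} → Injective _≡_ _≡_ (λ i → f i % n) →
    (∀ i → f i % n ≢ r % n) → Injective _≡_ _≡_ (λ i → (r ◂ f) i % n)
  ◂-%-injective inj apart {Fin.zero}  {Fin.zero}  _  = refl
  ◂-%-injective inj apart {Fin.zero}  {Fin.suc j} eq = ⊥-elim (apart j (sym eq))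
  ◂-%-injective inj apart {Fin.suc i} {Fin.zero}  eq = ⊥-elim (apart i eq)
  ◂-%-injective inj apart {Fin.suc i} {Fin.suc j} eq = cong Fin.suc (inj eq)

∣1+n∣n⇒≡1 : ∀ {d n} → d ∣ suc n → d ∣ n → d ≡ 1
∣1+n∣n⇒≡1 {d} {n} d∣1+n d∣n = ∣1⇒≡1 (∣m+n∣m⇒∣n (subst (d ∣_) (+-comm 1 n) d∣1+n) d∣n)

≢1-divisors-of-consecutive⇒3≤ : ∀ {m d e n} .{{_ : NonZero m}} → d ∣ m → e ∣ m →
  d ≢ 1 → e ≢ 1 → d ∣ suc n → e ∣ n → 3 ≤ m
≢1-divisors-of-consecutive⇒3≤ {1} d∣m _ d≢1 _ _ _ = ⊥-elim (d≢1 (∣1⇒≡1 d∣m))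
≢1-divisors-of-consecutive⇒3≤ {2} d∣m e∣m d≢1 e≢1 d∣1+n e∣n
  with irreducible[2] d∣m | irreducible[2] e∣m
... | inj₁ d≡1  | _         = ⊥-elim (d≢1 d≡1)
... | _         | inj₁ e≡1  = ⊥-elim (e≢1 e≡1)
... | inj₂ refl | inj₂ refl with ∣1+n∣n⇒≡1 d∣1+n e∣n
...   | ()
≢1-divisors-of-consecutive⇒3≤ {suc (suc (suc _))} _ _ _ _ _ _ = s≤s (s≤s (s≤s z≤n))

1%n≢pred[n]%n : ∀ n .{{_ : NonZero n}} → 3 ≤ n → 1 % n ≢ pred n % n
1%n≢pred[n]%n (suc (suc (suc k))) (s≤s (s≤s (s≤s z≤n))) eq
  with trans eq (m<n⇒m%n≡m (n<1+n (suc (suc k))))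
... | ()

σ-++ : ∀ xs ys → σ (xs ++ ys) ≡ σ xs ℤ.+ σ ys
σ-++ []       ys = sym (ℤ.+-identityˡ (σ ys))
σ-++ (x ∷ xs) ys = trans (cong (λ s → x ℤ.+ s) (σ-++ xs ys)) (sym (ℤ.+-assoc x (σ xs) (σ ys)))

σ-^^ : ∀ z k → σ (z ^^ k) ≡ + k ℤ.* z
σ-^^ z zero    = sym (ℤ.*-zeroˡ z)
σ-^^ z (suc k) = trans (cong (λ s → z ℤ.+ s) (σ-^^ z k)) (sym (ℤ.suc-* (+ k) z))

^^-⊆ : ∀ z {k l} → k ≤ l → z ^^ k ⊆ z ^^ l
^^-⊆ z {l = zero}  z≤n       = []
^^-⊆ z {l = suc l} z≤n       = z ∷ʳ ^^-⊆ z z≤n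
^^-⊆ z             (s≤s k≤l) = refl ∷ ^^-⊆ z k≤l

blocks : (x y m a b c : ℕ) → Seq
blocks x y m a b c = ((+ x) ^^ a) ++ (((+ y) ^^ b) ++ ((- + m) ^^ c))

length-blocks : ∀ x y m a b c → length (blocks x y m a b c) ≡ a + (b + c)
length-blocks x y m a b c = trans (length-++ ((+ x) ^^ a))
  (cong₂ _+_ (length-replicate a)
    (trans (length-++ ((+ y) ^^ b)) (cong₂ _+_ (length-replicate b) (length-replicate c))))

σ-blocks : ∀ x y m a b c → σ (blocks x y m a b c) ≡ + (a * x + b * y) ℤ.- + (c * m)
σ-blocks x y m a b c = begin
  σ (blocks x y m a b c)
    ≡⟨ σ-++ ((+ x) ^^ a) _ ⟩
  σ ((+ x) ^^ a) ℤ.+ σ (((+ y) ^^ b) ++ ((- + m) ^^ c))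
    ≡⟨ cong (λ s → σ ((+ x) ^^ a) ℤ.+ s) (σ-++ ((+ y) ^^ b) _) ⟩
  σ ((+ x) ^^ a) ℤ.+ (σ ((+ y) ^^ b) ℤ.+ σ ((- + m) ^^ c))
    ≡⟨ cong₂ ℤ._+_ (σ-^^ (+ x) a) (cong₂ ℤ._+_ (σ-^^ (+ y) b) (σ-^^ (- + m) c)) ⟩
  + a ℤ.* + x ℤ.+ (+ b ℤ.* + y ℤ.+ + c ℤ.* - + m)
    ≡⟨ cong₂ ℤ._+_ (sym (ℤ.pos-* a x))
         (cong₂ ℤ._+_ (sym (ℤ.pos-* b y)) (sym (ℤ.neg-distribʳ-* (+ c) (+ m)))) ⟩
  + (a * x) ℤ.+ (+ (b * y) ℤ.- + c ℤ.* + m)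
    ≡⟨ cong (λ s → + (a * x) ℤ.+ (+ (b * y) ℤ.- s)) (sym (ℤ.pos-* c m)) ⟩
  + (a * x) ℤ.+ (+ (b * y) ℤ.- + (c * m))
    ≡⟨ ℤ.+-assoc (+ (a * x)) (+ (b * y)) (- + (c * m)) ⟨
  + (a * x) ℤ.+ + (b * y) ℤ.- + (c * m)
    ≡⟨ cong (ℤ._- + (c * m)) (ℤ.pos-+ (a * x) (b * y)) ⟨
  + (a * x + b * y) ℤ.- + (c * m) ∎
  where open ≡-Reasoning

zeroSum-blocks⇔ : ∀ x y m a b c → IsZeroSum (blocks x y m a b c) ⇔ (a * x + b * y ≡ c * m)
zeroSum-blocks⇔ x y m a b c = mk⇔
  (λ σ≡0 → ℤ.+-injective (ℤ.i-j≡0⇒i≡j _ _ (trans (sym (σ-blocks x y m a b c)) σ≡0)))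
  (λ balanced → trans (σ-blocks x y m a b c) (ℤ.i≡j⇒i-j≡0 (cong +_ balanced)))

blocks-⊆ : ∀ x y m {a b c a' b' c'} → a' ≤ a → b' ≤ b → c' ≤ c →
  blocks x y m a' b' c' ⊆ blocks x y m a b c
blocks-⊆ x y m a'≤a b'≤b c'≤c = ++⁺ (^^-⊆ (+ x) a'≤a) (++⁺ (^^-⊆ (+ y) b'≤b) (^^-⊆ (- + m) c'≤c))

minimal-blocks⇒∤ : ∀ x y m a b c .{{_ : NonZero m}} → IsMinimalZeroSum (blocks x y m a b c) →
  ∀ {a' b'} → a' ≤ a → b' ≤ b → 0 < a' + b' → a' + b' < a + b → m ∤ a' * x + b' * y
minimal-blocks⇒∤ x y m a b c (zeroSum , minimal) {a'} {b'} a'≤a b'≤b 0<a'+b' a'+b'<a+b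
                 (divides c' balanced') =
  minimal (blocks x y m a' b' c') (blocks-⊆ x y m a'≤a b'≤b c'≤c)
    (subst (0 <_) (sym (length-blocks x y m a' b' c'))
      (subst (0 <_) (+-assoc a' b' c') (<-≤-trans 0<a'+b' (m≤m+n (a' + b') c'))))
    (subst₂ _<_ (sym (length-blocks x y m a' b' c')) (sym (length-blocks x y m a b c))
      (subst₂ _<_ (+-assoc a' b' c') (+-assoc a b c) (+-mono-<-≤ a'+b'<a+b c'≤c)))
    (Equivalence.from (zeroSum-blocks⇔ x y m a' b' c') balanced')
  where
    c'≤c : c' ≤ c
    c'≤c = *-cancelʳ-≤ c' c m
      (subst₂ _≤_ balanced' (Equivalence.to (zeroSum-blocks⇔ x y m a b c) zeroSum)
        (+-mono-≤ (*-monoˡ-≤ x a'≤a) (*-monoˡ-≤ y b'≤b)))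

module Staircase {m x y a b : ℕ} .{{_ : NonZero m}}
  (indivisible : ∀ {a' b'} → a' ≤ a → b' ≤ b → 0 < a' + b' → a' + b' < a + b → m ∤ a' * x + b' * y)
  where

  weight : ℕ → ℕ → ℕ
  weight i j = i * x + j * y

  weight-+ : ∀ i j k l → weight (i + k) (j + l) ≡ weight i j + weight k l
  weight-+ i j k l = trans (cong₂ _+_ (*-distribʳ-+ x i k) (*-distribʳ-+ y j l))
    (interchange (i * x) (k * x) (j * y) (l * y))

  weight-%-apart : ∀ {i j} k l → i + k ≤ a → j + l ≤ b → 0 < k + l → k + l < a + b →
    weight i j % m ≢ weight (i + k) (j + l) % m
  weight-%-apart {i} {j} k l i+k≤a j+l≤b 0<k+l k+l<a+b eq =
    indivisible (≤-trans (m≤n+m k i) i+k≤a) (≤-trans (m≤n+m l j) j+l≤b) 0<k+l k+l<a+b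
      (m%n≡[m+o]%n⇒n∣o (weight i j) (weight k l) (trans eq (cong (_% m) (weight-+ i j k l))))

  -- The sum of the first k terms of x^a y^b, listed with the copies of x first.
  stair : ℕ → ℕ
  stair k = weight (a ⊓ k) (k ∸ a)

  stair-%-apart : ∀ {i j} → i < j → j < a + b → stair i % m ≢ stair j % m
  stair-%-apart {i} {j} i<j j<a+b =
    subst (λ s → stair i % m ≢ s % m) (cong₂ weight a⊓i+k≡a⊓j i∸a+l≡j∸a)
      (weight-%-apart k l
        (subst (_≤ a) (sym a⊓i+k≡a⊓j) (m⊓n≤m a j))
        (subst (_≤ b) (sym i∸a+l≡j∸a) (subst (j ∸ a ≤_) (m+n∸m≡n a b) (∸-monoˡ-≤ a (<⇒≤ j<a+b))))
        (+-cancelˡ-< i 0 (k + l) (subst₂ _<_ (sym (+-identityʳ i)) (sym i+[k+l]≡j) i<j))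
        (≤-<-trans (subst (k + l ≤_) i+[k+l]≡j (m≤n+m (k + l) i)) j<a+b))
    where
      k = a ⊓ j ∸ a ⊓ i
      l = (j ∸ a) ∸ (i ∸ a)

      a⊓i+k≡a⊓j : a ⊓ i + k ≡ a ⊓ j
      a⊓i+k≡a⊓j = m+[n∸m]≡n (⊓-monoʳ-≤ a (<⇒≤ i<j))

      i∸a+l≡j∸a : i ∸ a + l ≡ j ∸ a
      i∸a+l≡j∸a = m+[n∸m]≡n (∸-monoˡ-≤ a (<⇒≤ i<j))

      i+[k+l]≡j : i + (k + l) ≡ j
      i+[k+l]≡j = begin
        i + (k + l)               ≡⟨ cong (_+ (k + l)) (m⊓n+n∸m≡n a i) ⟨
        a ⊓ i + (i ∸ a) + (k + l) ≡⟨ interchange (a ⊓ i) (i ∸ a) k l ⟩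
        a ⊓ i + k + (i ∸ a + l)   ≡⟨ cong₂ _+_ a⊓i+k≡a⊓j i∸a+l≡j∸a ⟩
        a ⊓ j + (j ∸ a)           ≡⟨ m⊓n+n∸m≡n a j ⟩
        j                         ∎
        where open ≡-Reasoning

  stair-%-injective : Injective _≡_ _≡_ (λ (k : Fin (a + b)) → stair (toℕ k) % m)
  stair-%-injective {i} {j} eq with Finₚ.<-cmp i j
  ... | tri< i<j _ _ = ⊥-elim (stair-%-apart i<j (toℕ<n j) eq)
  ... | tri≈ _ i≡j _ = i≡j
  ... | tri> _ _ j<i = ⊥-elim (stair-%-apart j<i (toℕ<n i) (sym eq))

  stair-+ : ∀ t → stair (a + t) ≡ weight a t
  stair-+ t = cong₂ weight (m≤n⇒m⊓n≡m (m≤m+n a t)) (m+n∸m≡n a t)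

  stair-%-apart-y : 0 < a → ∀ t → suc a + t < a + b → stair (suc a + t) % m ≢ y % m
  stair-%-apart-y 0<a t 1+a+t<a+b eq =
    weight-%-apart {0} {1} a t ≤-refl (<⇒≤ 1+t<b) (≤-trans 0<a (m≤m+n a t))
      (+-monoʳ-< a (<-trans (n<1+n t) 1+t<b))
      (begin
        (y + 0) % m           ≡⟨ cong (_% m) (+-identityʳ y) ⟩
        y % m                 ≡⟨ eq ⟨
        stair (suc a + t) % m ≡⟨ cong (λ s → stair s % m) (+-suc a t) ⟨
        stair (a + suc t) % m ≡⟨ cong (_% m) (stair-+ (suc t)) ⟩
        weight a (suc t) % m  ∎)
    where
      open ≡-Reasoning
      1+t<b : suc t < b
      1+t<b = +-cancelˡ-< a (suc t) b (subst (_< a + b) (sym (+-suc a t)) 1+a+t<a+b)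

  ∣x⇒∣stair : ∀ {d k} → d ∣ x → k ≤ a → d ∣ stair k
  ∣x⇒∣stair {d} {k} d∣x k≤a =
    subst (d ∣_) (cong₂ weight (sym (m≥n⇒m⊓n≡n k≤a)) (sym (m≤n⇒m∸n≡0 k≤a)))
      (∣m∣n⇒∣m+n (∣n⇒∣m*n k d∣x) (d ∣0))

  ∣a∧∣y⇒∣stair : ∀ {d k} → d ∣ a → d ∣ y → a ≤ k → d ∣ stair k
  ∣a∧∣y⇒∣stair {d} {k} d∣a d∣y a≤k =
    subst (d ∣_) (cong (λ i → weight i (k ∸ a)) (sym (m≤n⇒m⊓n≡m a≤k)))
      (∣m∣n⇒∣m+n (∣m⇒∣m*n x d∣a) (∣n⇒∣m*n (k ∸ a) d∣y))

k+[a+b]+[1+c]≡a+[b+c]+[1+k] : ∀ k a b c → k + (a + b) + suc c ≡ a + (b + c) + suc k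
k+[a+b]+[1+c]≡a+[b+c]+[1+k] = solve-∀

module LengthBounds {m y a b c : ℕ} .{{_ : NonZero m}}
  (balanced : a * suc y + b * y ≡ c * m)
  (indivisible : ∀ {a' b'} → a' ≤ a → b' ≤ b → 0 < a' + b' → a' + b' < a + b → m ∤ a' * suc y + b' * y)
  where
  open Staircase indivisible

  c<1+y : a + b < m → c < suc y
  c<1+y a+b<m = *-cancelʳ-< m c (suc y) (begin-strict
    c * m                 ≡⟨ balanced ⟨
    a * suc y + b * y     ≤⟨ +-monoʳ-≤ (a * suc y) (*-monoʳ-≤ b (n≤1+n y)) ⟩
    a * suc y + b * suc y ≡⟨ *-distribʳ-+ (suc y) a b ⟨
    (a + b) * suc y       <⟨ *-monoˡ-< (suc y) a+b<m ⟩
    m * suc y             ≡⟨ *-comm m (suc y) ⟩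
    suc y * m             ∎)
    where open ≤-Reasoning

  1+a+b≤m : 0 < a → gcd m (suc y) ≢ 1 → suc (a + b) ≤ m
  1+a+b≤m 0<a d≢1 = %-injective⇒≤ (◂-%-injective stair-%-injective (λ k → y-apart (toℕ k) (toℕ<n k)))
    where
      d∣m = gcd[m,n]∣m m (suc y)
      d∣1+y = gcd[m,n]∣n m (suc y)

      d∤y : gcd m (suc y) ∤ y
      d∤y d∣y = d≢1 (∣1+n∣n⇒≡1 d∣1+y d∣y)

      y-apart : ∀ k → k < a + b → stair k % m ≢ y % m
      y-apart k k<a+b with k ≤? a
      ... | yes k≤a = d∤y ∘ ∣n∣m∧m%n≡o%n⇒∣o d∣m (∣x⇒∣stair d∣1+y k≤a)
      ... | no k≰a with m≤n⇒∃[o]m+o≡n (≰⇒> k≰a)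
      ...   | t , refl = stair-%-apart-y 0<a t k<a+b

  2+a+b≤m : gcd m (suc y) ≢ 1 → gcd m y ≢ 1 → 2 + (a + b) ≤ m
  2+a+b≤m d≢1 e≢1 = %-injective⇒≤
    (◂-%-injective (◂-%-injective stair-%-injective (λ k → apart 1 (d≢1 ∘ ∣1⇒≡1) (e≢1 ∘ ∣1⇒≡1) (toℕ k)))
      λ { Fin.zero    → 1%n≢pred[n]%n m (≢1-divisors-of-consecutive⇒3≤ d∣m e∣m d≢1 e≢1 d∣1+y e∣y)
        ; (Fin.suc k) → apart (pred m) (∤pred d∣m d≢1) (∤pred e∣m e≢1) (toℕ k) })
    where
      d∣m = gcd[m,n]∣m m (suc y)
      d∣1+y = gcd[m,n]∣n m (suc y)
      e∣m = gcd[m,n]∣m m y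
      e∣y = gcd[m,n]∣n m y

      ∤pred : ∀ {d} → d ∣ m → d ≢ 1 → d ∤ pred m
      ∤pred {d} d∣m d≢1 d∣pred = d≢1 (∣1+n∣n⇒≡1 (subst (d ∣_) (sym (suc-pred m)) d∣m) d∣pred)

      e∣a : gcd m y ∣ a
      e∣a = ∣m+n∣m⇒∣n (subst (gcd m y ∣_) c*m≡a*y+b*y+a (∣n⇒∣m*n c e∣m))
        (∣m∣n⇒∣m+n (∣n⇒∣m*n a e∣y) (∣n⇒∣m*n b e∣y))
        where
          open ≡-Reasoning
          c*m≡a*y+b*y+a : c * m ≡ a * y + b * y + a
          c*m≡a*y+b*y+a = begin
            c * m                 ≡⟨ balanced ⟨
            a * suc y + b * y     ≡⟨ cong (_+ b * y) (*-suc a y) ⟩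
            a + a * y + b * y     ≡⟨ +-assoc a (a * y) (b * y) ⟩
            a + (a * y + b * y)   ≡⟨ +-comm a _ ⟩
            a * y + b * y + a     ∎

      apart : ∀ r → gcd m (suc y) ∤ r → gcd m y ∤ r → ∀ k → stair k % m ≢ r % m
      apart r d∤r e∤r k eq with ≤-total k a
      ... | inj₁ k≤a = d∤r (∣n∣m∧m%n≡o%n⇒∣o d∣m (∣x⇒∣stair d∣1+y k≤a) eq)
      ... | inj₂ a≤k = e∤r (∣n∣m∧m%n≡o%n⇒∣o e∣m (∣a∧∣y⇒∣stair e∣a e∣y a≤k) eq)

  length-bound : ∀ k → suc k + (a + b) ≤ m → a + (b + c) + suc (suc k) ≤ m + suc y
  length-bound k 1+k+a+b≤m = subst (_≤ m + suc y) (k+[a+b]+[1+c]≡a+[b+c]+[1+k] (suc k) a b c)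
    (+-mono-≤ 1+k+a+b≤m (c<1+y (<-≤-trans (s≤s (m≤n+m (a + b) k)) 1+k+a+b≤m)))

lemma3p9 : (m M : ℕ) → 0 < m → 0 < M → ¬ (gcd m M ≡ 1) →
    (α β γ : ℕ) →
    let S = ((+ M) ^^ α) ++ (((+ (M ∸ 1)) ^^ β) ++ ((- (+ m)) ^^ γ)) in
    IsOver (- (+ m)) (+ M) S → IsMinimalZeroSum S →
    ((0 < α → length S + 2 ≤ m + M) ×
     (¬ (gcd m (M ∸ 1) ≡ 1) → length S + 3 ≤ m + M))
-- The entries of S lie in ⟦-m, M⟧ by construction, so that hypothesis is not needed.
lemma3p9 m@(suc _) (suc y) _ _ d≢1 α β γ _ minimal =
  (λ 0<α → bound 0 (1+a+b≤m 0<α d≢1)) , (λ e≢1 → bound 1 (2+a+b≤m d≢1 e≢1))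
  where
    open LengthBounds {c = γ} (Equivalence.to (zeroSum-blocks⇔ (suc y) y m α β γ) (proj₁ minimal))
                      (minimal-blocks⇒∤ (suc y) y m α β γ minimal)

    bound : ∀ k → suc k + (α + β) ≤ m → length (blocks (suc y) y m α β γ) + suc (suc k) ≤ m + suc y
    bound k h = subst (λ n → n + suc (suc k) ≤ m + suc y) (sym (length-blocks (suc y) y m α β γ))
      (length-bound k h)
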